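{- If $Y\subseteq X\subseteq S$, then $\sum_{i\in\mathrm{Top}(Y)}\pi(i)\le\sum_{i\in\mathrm{Top}(X)}\pi(i)$.
   Context: $S$ is a finite rooted tree with root $r$. Each non-root state $i$ has a unique parent $\mathrm{pa}(i)$, and $\mathrm{child}(i)=\{k:\mathrm{pa}(k)=i\}$. There are transition probabilities $P(\mathrm{pa}(i),i)>0$ with $\sum_{k\in\mathrm{child}(i)}P(i,k)\le1$ for every $i$. Notation: - $\mathrm{anc}(i)$ is the set of states on the path from $r$ to $i$, inclusive. - $\pi(r)=1$ and $\pi(i)=\prod_{k\in\mathrm{anc}(i)\setminus\{r\}}P(\mathrm{pa}(k),k)$. - For $X\subseteq S$, the top set $\mathrm{Top}(X)=\{i\in X:\mathrm{anc}(i)\cap X=\{i\}\}$ is the set of elements of $X$ having no proper ancestor in $X$.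
   Formalization: The transition probabilities $P(\mathrm{pa}(i),i)$ are rational, and hence so are the values $\pi(i)$. -}

module Defs where

open import Data.Nat using (ℕ; zero; suc)
open import Data.Fin using (Fin; zero; suc)
import Data.Fin as F
open import Data.Fin.Subset using (Subset; _∈_; _⊆_)
open import Data.Vec using ([]; _∷_)
open import Data.Bool using (Bool; true; false; if_then_else_)
open import Data.Maybe using (Maybe; just; nothing)
import Data.Maybe.Properties as MP
open import Data.Rational using (ℚ; 0ℚ; 1ℚ; _+_; _*_; _≤_; _<_)
open import Data.Product using (_×_)
open import Relation.Nullary using (does)
open import Relation.Binary.PropositionalEquality using (_≡_; _≢_)

sumFin : ∀ {n} → (Fin n → ℚ) → ℚ
sumFin {zero}  f = 0ℚ
sumFin {suc n} f = f zero + sumFin (λ i → f (suc i))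

subsetSum : ∀ {n} → Subset n → (Fin n → ℚ) → ℚ
subsetSum []      f = 0ℚ
subsetSum (b ∷ T) f = (if b then f zero else 0ℚ) + subsetSum T (λ i → f (suc i))

-- Ancestor-or-self relation w.r.t. a (partial) parent map:
-- j ≼ i  iff  j lies on the parent chain starting from i (i included).
data Anc {n} (pa : Fin n → Maybe (Fin n)) : Fin n → Fin n → Set where
  here : ∀ {i} → Anc pa i i
  up   : ∀ {j i k} → pa i ≡ just k → Anc pa j k → Anc pa j i

record RootedTree (n : ℕ) : Set where
  field
    root    : Fin n
    pa      : Fin n → Maybe (Fin n)
    pa-root : pa root ≡ nothing
    reach   : ∀ i → Anc pa root i

  _≼_ : Fin n → Fin n → Set
  j ≼ i = Anc pa j i

  pathProd : (P : Fin n → ℚ) → ∀ {j i} → Anc pa j i → ℚ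
  pathProd P here          = 1ℚ
  pathProd P (up {i = i} _ c) = P i * pathProd P c

  -- π(i) = ∏_{k ∈ anc(i) \ {r}} P(pa(k),k); here P k stands for P(pa(k),k)
  π : (P : Fin n → ℚ) → Fin n → ℚ
  π P i = pathProd P (reach i)

  childSum : (P : Fin n → ℚ) → Fin n → ℚ
  childSum P i = sumFin (λ k → if does (MP.≡-dec F._≟_ (pa k) (just i)) then P k else 0ℚ)

  IsTop : Subset n → Subset n → Set
  IsTop X T = ∀ i → (i ∈ T → i ∈ X × (∀ j → j ∈ X → j ≼ i → j ≡ i))
                  × (i ∈ X × (∀ j → j ∈ X → j ≼ i → j ≡ i) → i ∈ T)

-- Transition probabilities: P k = P(pa(k),k) for non-root k.
record Transitions {n} (t : RootedTree n) (P : Fin n → ℚ) : Set where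
  open RootedTree t
  field
    pos   : ∀ k → k ≢ root → 0ℚ < P k
    substoch : ∀ i → childSum P i ≤ 1ℚ

{-# OPTIONS --safe #-}
-- Read π(i) as the probability that a random walk started at r visits i, where the walk
-- moves from i to a child k with probability P(i,k) and stops at i otherwise.  The mass absorbed
-- at w is α(w) = π(w) - Σ_{k ∈ child(w)} π(k) = π(w)(1 - Σ_k P(w,k)) ≥ 0, and
-- telescoping over the subtree of u gives π(u) = Σ_{u ≼ w} α(w).  The elements of Top(X)
-- are pairwise incomparable and every element of X lies below one of them, so
-- Σ_{i ∈ Top(X)} π(i) is the total α-mass of the states lying below some element of X,
-- which is monotone in X.
module Submission where

open import Defs
open import Data.Nat using (zero; suc)
open import Data.Fin using (Fin; zero; suc; punchIn)
import Data.Fin as F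
open import Data.Fin.Properties using (punchInᵢ≢i; any?)
open import Data.Fin.Subset using (Subset; _∈_; _⊆_; inside; outside)
open import Data.Fin.Subset.Properties using (_∈?_)
open import Data.Vec using ([]; _∷_)
open import Data.Vec.Functional using (removeAt)
open import Data.Bool using (if_then_else_)
open import Data.Maybe using (Maybe; just; nothing; maybe)
open import Data.Maybe.Properties using (just-injective)
import Data.Maybe.Properties as MP
open import Data.Rational using (ℚ; 0ℚ; 1ℚ; _+_; _*_; _-_; -_; _≤_; nonNegative)
open import Data.Rational.Properties
open import Data.Product using (∃-syntax; _×_; _,_; proj₁; proj₂)
open import Data.Sum using (_⊎_; inj₁; inj₂; [_,_])
open import Data.Empty using (⊥-elim)
open import Function using (_∘_; id)
open import Relation.Nullary using (Dec; yes; no; ¬_; does)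
open import Relation.Nullary.Decidable using (map′; _×-dec_; _⊎-dec_)
open import Relation.Binary.PropositionalEquality using (_≡_; _≢_; refl; sym; trans; cong; cong₂; subst; module ≡-Reasoning)
open import Algebra.Bundles using (CommutativeRing; CommutativeMonoid)
open import Algebra.Properties.Semiring.Sum (CommutativeRing.semiring +-*-commutativeRing)
  using (sum; sum-cong-≗; sum-replicate-zero; sum-remove; ∑-distrib-+; ∑-comm; *-distribˡ-sum; *-distribʳ-sum)
open import Algebra.Properties.CommutativeSemigroup (CommutativeMonoid.commutativeSemigroup +-0-commutativeMonoid)
  using () renaming (interchange to +-interchange)
open import Algebra.Properties.Group +-0-group using () renaming (//-rightDividesʳ to y+x-x≡y)
open import Algebra.Properties.Ring +-*-ring using (x[y-z]≈xy-xz)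
open import Axiom.UniquenessOfIdentityProofs using (module Decidable⇒UIP)

infix 4 _≟ₘ_
_≟ₘ_ : ∀ {n} (x y : Maybe (Fin n)) → Dec (x ≡ y)
_≟ₘ_ = MP.≡-dec F._≟_

𝟙 : ∀ {a} {A : Set a} → Dec A → ℚ
𝟙 a? = if does a? then 1ℚ else 0ℚ

𝟙-yes : ∀ {a} {A : Set a} → A → (a? : Dec A) → 𝟙 a? ≡ 1ℚ
𝟙-yes _ (yes _) = refl
𝟙-yes a (no ¬a) = ⊥-elim (¬a a)

𝟙-no : ∀ {a} {A : Set a} → ¬ A → (a? : Dec A) → 𝟙 a? ≡ 0ℚ
𝟙-no ¬a (yes a) = ⊥-elim (¬a a)
𝟙-no ¬a (no _)  = refl

𝟙-mono : ∀ {a b} {A : Set a} {B : Set b} → (A → B) → (a? : Dec A) (b? : Dec B) → 𝟙 a? ≤ 𝟙 b?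
𝟙-mono _   (yes _) (yes _) = ≤-refl
𝟙-mono A→B (yes a) (no ¬b) = ⊥-elim (¬b (A→B a))
𝟙-mono _   (no _)  (yes _) = nonNegative⁻¹ 1ℚ
𝟙-mono _   (no _)  (no _)  = ≤-refl

𝟙-cong : ∀ {a b} {A : Set a} {B : Set b} → (A → B) → (B → A) → (a? : Dec A) (b? : Dec B) → 𝟙 a? ≡ 𝟙 b?
𝟙-cong A→B B→A a? b? = ≤-antisym (𝟙-mono A→B a? b?) (𝟙-mono B→A b? a?)

𝟙-× : ∀ {a b} {A : Set a} {B : Set b} (a? : Dec A) (b? : Dec B) → 𝟙 a? * 𝟙 b? ≡ 𝟙 (a? ×-dec b?)
𝟙-× (yes _) (yes _) = refl
𝟙-× (yes _) (no _)  = refl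
𝟙-× (no _)  (yes _) = refl
𝟙-× (no _)  (no _)  = refl

𝟙-⊎ : ∀ {a b} {A : Set a} {B : Set b} → ¬ (A × B) → (a? : Dec A) (b? : Dec B) → 𝟙 (a? ⊎-dec b?) ≡ 𝟙 a? + 𝟙 b?
𝟙-⊎ disjoint (yes a) (yes b) = ⊥-elim (disjoint (a , b))
𝟙-⊎ _        (yes _) (no _)  = refl
𝟙-⊎ _        (no _)  (yes _) = refl
𝟙-⊎ _        (no _)  (no _)  = refl

sumFin≡sum : ∀ {n} (f : Fin n → ℚ) → sumFin f ≡ sum f
sumFin≡sum {zero}  f = refl
sumFin≡sum {suc n} f = cong (f zero +_) (sumFin≡sum (f ∘ suc))

subsetSum≡sum : ∀ {n} (T : Subset n) (f : Fin n → ℚ) → subsetSum T f ≡ sum (λ i → 𝟙 (i ∈? T) * f i)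
subsetSum≡sum []            f = refl
subsetSum≡sum (inside ∷ T)  f = cong₂ _+_ (sym (*-identityˡ (f zero))) (subsetSum≡sum T (f ∘ suc))
subsetSum≡sum (outside ∷ T) f = cong₂ _+_ (sym (*-zeroˡ (f zero))) (subsetSum≡sum T (f ∘ suc))

sum-zero : ∀ {n} {f : Fin n → ℚ} → (∀ i → f i ≡ 0ℚ) → sum f ≡ 0ℚ
sum-zero {n} f≡0 = trans (sum-cong-≗ f≡0) (sum-replicate-zero n)

sum-single : ∀ {n} {f : Fin n → ℚ} k → (∀ i → i ≢ k → f i ≡ 0ℚ) → sum f ≡ f k
sum-single {suc n} {f} k f≡0 = begin
  sum f                     ≡⟨ sum-remove {i = k} f ⟩
  f k + sum (removeAt f k)  ≡⟨ cong (f k +_) (sum-zero (λ j → f≡0 (punchIn k j) (punchInᵢ≢i k j))) ⟩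
  f k + 0ℚ                  ≡⟨ +-identityʳ (f k) ⟩
  f k                       ∎
  where open ≡-Reasoning

sum-δ : ∀ {n} (f : Fin n → ℚ) (m : Maybe (Fin n)) → sum (λ i → f i * 𝟙 (m ≟ₘ just i)) ≡ maybe f 0ℚ m
sum-δ f nothing  = sum-zero (λ i → *-zeroʳ (f i))
sum-δ f (just k) = begin
  sum (λ i → f i * 𝟙 (k F.≟ i))  ≡⟨ sum-single k (λ i i≢k → trans (cong (f i *_) (𝟙-no (i≢k ∘ sym) (k F.≟ i))) (*-zeroʳ (f i))) ⟩
  f k * 𝟙 (k F.≟ k)              ≡⟨ cong (f k *_) (𝟙-yes refl (k F.≟ k)) ⟩
  f k * 1ℚ                       ≡⟨ *-identityʳ (f k) ⟩
  f k                            ∎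
  where open ≡-Reasoning

sum-distrib-minus : ∀ {n} (f g : Fin n → ℚ) → sum (λ i → f i - g i) ≡ sum f - sum g
sum-distrib-minus {zero}  f g = refl
sum-distrib-minus {suc n} f g = begin
  (f zero - g zero) + sum (λ i → f (suc i) - g (suc i))  ≡⟨ cong (f zero - g zero +_) (sum-distrib-minus (f ∘ suc) (g ∘ suc)) ⟩
  (f zero - g zero) + (sum (f ∘ suc) - sum (g ∘ suc))    ≡⟨ +-interchange (f zero) (- g zero) (sum (f ∘ suc)) _ ⟩
  (f zero + sum (f ∘ suc)) + (- g zero - sum (g ∘ suc))  ≡⟨ cong (f zero + sum (f ∘ suc) +_) (neg-distrib-+ (g zero) (sum (g ∘ suc))) ⟨
  (f zero + sum (f ∘ suc)) - (g zero + sum (g ∘ suc))    ∎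
  where open ≡-Reasoning

sum-mono-≤ : ∀ {n} {f g : Fin n → ℚ} → (∀ i → f i ≤ g i) → sum f ≤ sum g
sum-mono-≤ {zero}  f≤g = ≤-refl
sum-mono-≤ {suc n} f≤g = +-mono-≤ (f≤g zero) (sum-mono-≤ (f≤g ∘ suc))

sum-matrix-assoc : ∀ {m n} (x : Fin m → ℚ) (K : Fin m → Fin n → ℚ) (y : Fin n → ℚ) →
                 sum (λ i → x i * sum (λ j → K i j * y j)) ≡ sum (λ j → sum (λ i → x i * K i j) * y j)
sum-matrix-assoc x K y = begin
  sum (λ i → x i * sum (λ j → K i j * y j))    ≡⟨ sum-cong-≗ (λ i → *-distribˡ-sum (x i) (λ j → K i j * y j)) ⟩
  sum (λ i → sum (λ j → x i * (K i j * y j)))  ≡⟨ sum-cong-≗ (λ i → sum-cong-≗ (λ j → *-assoc (x i) (K i j) (y j))) ⟨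
  sum (λ i → sum (λ j → x i * K i j * y j))    ≡⟨ ∑-comm (λ i j → x i * K i j * y j) ⟩
  sum (λ j → sum (λ i → x i * K i j * y j))    ≡⟨ sum-cong-≗ (λ j → *-distribʳ-sum (y j) (λ i → x i * K i j)) ⟨
  sum (λ j → sum (λ i → x i * K i j) * y j)    ∎
  where open ≡-Reasoning

module Ancestry {n} (t : RootedTree n) where
  open RootedTree t

  parentless⇒root : ∀ {i} → pa i ≡ nothing → i ≡ root
  parentless⇒root {i} pa-i with reach i
  ... | here       = refl
  ... | up pa-i′ _ with () ← trans (sym pa-i′) pa-i

  child≢root : ∀ {i k} → pa i ≡ just k → i ≢ root
  child≢root pa-i refl with () ← trans (sym pa-i) pa-root

  ≼root⇒≡root : ∀ {j} → j ≼ root → j ≡ root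
  ≼root⇒≡root here         = refl
  ≼root⇒≡root (up pa-r _) = ⊥-elim (child≢root pa-r refl)

  ≼-trans : ∀ {a b c} → a ≼ b → b ≼ c → a ≼ c
  ≼-trans a≼b here          = a≼b
  ≼-trans a≼b (up pa-c b≼k) = up pa-c (≼-trans a≼b b≼k)

  ≼-step : ∀ {j i k} → pa i ≡ just k → j ≼ i → j ≡ i ⊎ j ≼ k
  ≼-step pa-i here             = inj₁ refl
  ≼-step pa-i (up pa-i′ j≼k′) with refl ← just-injective (trans (sym pa-i′) pa-i) = inj₂ j≼k′

  child⋠parent : ∀ {i k} → pa i ≡ just k → ¬ i ≼ k
  child⋠parent {k = k} = go (reach k)
    where
    -- i ≼ k with k = pa i forces k ≼ pa k: the same situation one step closer to the root.
    go : ∀ {k} → root ≼ k → ∀ {i} → pa i ≡ just k → ¬ i ≼ k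
    go here pa-i i≼r = child≢root pa-i (≼root⇒≡root i≼r)
    go {k} (up pa-k r≼k′) pa-i i≼k with ≼-step pa-k i≼k
    ... | inj₁ refl = go r≼k′ pa-k (subst (k ≼_) (just-injective (trans (sym pa-i) pa-k)) here)
    ... | inj₂ i≼k′ = go r≼k′ pa-k (≼-trans (up pa-i here) i≼k′)

  ≼-irrelevant : ∀ {j i} (p q : j ≼ i) → p ≡ q
  ≼-irrelevant here           here            = refl
  ≼-irrelevant here           (up pa-i q)     = ⊥-elim (child⋠parent pa-i q)
  ≼-irrelevant (up pa-i p)    here            = ⊥-elim (child⋠parent pa-i p)
  ≼-irrelevant (up pa-i p)    (up pa-i′ q) with refl ← just-injective (trans (sym pa-i) pa-i′) =
    cong₂ up (Decidable⇒UIP.≡-irrelevant _≟ₘ_ pa-i pa-i′) (≼-irrelevant p q)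

  _≼?_ : ∀ j i → Dec (j ≼ i)
  j ≼? i = decide (reach i)
    where
    decide : ∀ {i} → root ≼ i → Dec (j ≼ i)
    decide here            = map′ (λ { refl → here }) ≼root⇒≡root (j F.≟ root)
    decide {i} (up pa-i r) = map′ [ (λ { refl → here }) , up pa-i ] (≼-step pa-i) ((j F.≟ i) ⊎-dec decide r)

  ≼-comparable : ∀ {a b w} → a ≼ w → b ≼ w → a ≼ b ⊎ b ≼ a
  ≼-comparable here          b≼w            = inj₂ b≼w
  ≼-comparable (up pa-w a≼k) here           = inj₁ (up pa-w a≼k)
  ≼-comparable (up pa-w a≼k) (up pa-w′ b≼k′) with refl ← just-injective (trans (sym pa-w) pa-w′) =
    ≼-comparable a≼k b≼k′

  𝟙≼-unfold : ∀ u c → 𝟙 (u ≼? c) ≡ 𝟙 (u F.≟ c) + maybe (λ k → 𝟙 (u ≼? k)) 0ℚ (pa c)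
  𝟙≼-unfold u c with pa c in pa-c
  ... | nothing with refl ← parentless⇒root pa-c =
    trans (𝟙-cong ≼root⇒≡root (λ { refl → here }) (u ≼? root) (u F.≟ root)) (sym (+-identityʳ _))
  ... | just k = trans (𝟙-cong (≼-step pa-c) [ (λ { refl → here }) , up pa-c ] (u ≼? c) ((u F.≟ c) ⊎-dec (u ≼? k)))
                       (𝟙-⊎ (λ { (refl , u≼k) → child⋠parent pa-c u≼k }) (u F.≟ c) (u ≼? k))

  Below : Subset n → Fin n → Set
  Below X w = ∃[ x ] x ∈ X × x ≼ w

  below? : ∀ X w → Dec (Below X w)
  below? X w = any? (λ x → (x ∈? X) ×-dec (x ≼? w))

  module TopSet {X T} (top : IsTop X T) where

    top⊆ : ∀ {i} → i ∈ T → i ∈ X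
    top⊆ i∈T = proj₁ (proj₁ (top _) i∈T)

    top-minimal : ∀ {i j} → i ∈ T → j ∈ X → j ≼ i → j ≡ i
    top-minimal i∈T j∈X = proj₂ (proj₁ (top _) i∈T) _ j∈X

    minimal⇒top : ∀ {i} → i ∈ X → (∀ j → j ∈ X → j ≼ i → j ≡ i) → i ∈ T
    minimal⇒top i∈X minimal = proj₂ (top _) (i∈X , minimal)

    top-antichain : ∀ {a b w} → a ∈ T → b ∈ T → a ≼ w → b ≼ w → a ≡ b
    top-antichain a∈T b∈T a≼w b≼w with ≼-comparable a≼w b≼w
    ... | inj₁ a≼b = top-minimal b∈T (top⊆ a∈T) a≼b
    ... | inj₂ b≼a = sym (top-minimal a∈T (top⊆ b∈T) b≼a)

    below-top : ∀ {i} → root ≼ i → Below X i → Below T i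
    below-top here (j , j∈X , j≼r) with refl ← ≼root⇒≡root j≼r =
      root , minimal⇒top j∈X (λ j′ _ → ≼root⇒≡root) , here
    below-top {i} (up {k = k} pa-i r≼k) (j , j∈X , j≼i) with below? X k
    ... | yes below-k with below-top r≼k below-k
    ...   | t , t∈T , t≼k = t , t∈T , up pa-i t≼k
    below-top {i} (up {k = k} pa-i r≼k) (j , j∈X , j≼i) | no ¬below-k =
      i , minimal⇒top (subst (_∈ X) (minimal j j∈X j≼i) j∈X) minimal , here
      where
      minimal : ∀ j′ → j′ ∈ X → j′ ≼ i → j′ ≡ i
      minimal j′ j′∈X j′≼i = [ id , (λ j′≼k → ⊥-elim (¬below-k (j′ , j′∈X , j′≼k))) ] (≼-step pa-i j′≼i)

    top-count : ∀ w → sum (λ b → 𝟙 (b ∈? T) * 𝟙 (b ≼? w)) ≡ 𝟙 (below? X w)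
    top-count w = trans (sum-cong-≗ (λ b → 𝟙-× (b ∈? T) (b ≼? w))) (count (below? X w))
      where
      top-above? : ∀ b → Dec (b ∈ T × b ≼ w)
      top-above? b = (b ∈? T) ×-dec (b ≼? w)
      count : (below-w? : Dec (Below X w)) → sum (λ b → 𝟙 (top-above? b)) ≡ 𝟙 below-w?
      count (yes below-w) with below-top (reach w) below-w
      ... | t , t∈T , t≼w =
        trans (sum-single t (λ b b≢t → 𝟙-no (λ (b∈T , b≼w) → b≢t (top-antichain b∈T t∈T b≼w t≼w)) (top-above? b)))
              (𝟙-yes (t∈T , t≼w) (top-above? t))
      count (no ¬below-w) = sum-zero (λ b → 𝟙-no (λ (b∈T , b≼w) → ¬below-w (b , top⊆ b∈T , b≼w)) (top-above? b))

module Absorption {n} {t : RootedTree n} {P : Fin n → ℚ} (tr : Transitions t P) where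
  open RootedTree t
  open Transitions tr
  open Ancestry t

  pathProd-nonneg : ∀ {j i} (p : j ≼ i) → 0ℚ ≤ pathProd P p
  pathProd-nonneg here           = nonNegative⁻¹ 1ℚ
  pathProd-nonneg (up {i = i} pa-i p) =
    nonNegative⁻¹ _ {{nonNeg*nonNeg⇒nonNeg (P i) {{nonNegative (<⇒≤ (pos i (child≢root pa-i)))}}
                                           _ {{nonNegative (pathProd-nonneg p)}}}}

  π-nonneg : ∀ i → 0ℚ ≤ π P i
  π-nonneg i = pathProd-nonneg (reach i)

  π-child : ∀ {c k} → pa c ≡ just k → π P c ≡ P c * π P k
  π-child {c} {k} pa-c = cong (pathProd P) (≼-irrelevant (reach c) (up pa-c (reach k)))

  outflow : Fin n → ℚ
  outflow w = sum (λ c → 𝟙 (pa c ≟ₘ just w) * π P c)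

  outflow≡childSum*π : ∀ w → outflow w ≡ childSum P w * π P w
  outflow≡childSum*π w = begin
    outflow w                      ≡⟨ sum-cong-≗ (λ c → edge c (pa c ≟ₘ just w)) ⟩
    sum (λ c → weight c * π P w)   ≡⟨ *-distribʳ-sum (π P w) weight ⟨
    sum weight * π P w             ≡⟨ cong (_* π P w) (sumFin≡sum weight) ⟨
    childSum P w * π P w           ∎
    where
    open ≡-Reasoning
    weight : Fin n → ℚ
    weight c = if does (pa c ≟ₘ just w) then P c else 0ℚ
    edge : ∀ c (d : Dec (pa c ≡ just w)) → 𝟙 d * π P c ≡ (if does d then P c else 0ℚ) * π P w
    edge c (yes pa-c) = trans (*-identityˡ (π P c)) (π-child pa-c)
    edge c (no _)     = trans (*-zeroˡ (π P c)) (sym (*-zeroˡ (π P w)))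

  absorbed : Fin n → ℚ
  absorbed w = π P w - outflow w

  absorbed-nonneg : ∀ w → 0ℚ ≤ absorbed w
  absorbed-nonneg w = begin
    0ℚ                            ≡⟨ +-inverseʳ (outflow w) ⟨
    outflow w - outflow w         ≤⟨ +-monoˡ-≤ (- outflow w) outflow≤π ⟩
    absorbed w                    ∎
    where
    open ≤-Reasoning
    outflow≤π : outflow w ≤ π P w
    outflow≤π = begin
      outflow w              ≡⟨ outflow≡childSum*π w ⟩
      childSum P w * π P w   ≤⟨ *-monoʳ-≤-nonNeg (π P w) {{nonNegative (π-nonneg w)}} (substoch w) ⟩
      1ℚ * π P w             ≡⟨ *-identityˡ (π P w) ⟩
      π P w                  ∎

  subtree-balance : ∀ u → sum (λ w → 𝟙 (u ≼? w) * π P w) ≡ π P u + sum (λ w → 𝟙 (u ≼? w) * outflow w)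
  subtree-balance u = begin
    sum (λ c → 𝟙 (u ≼? c) * π P c)
      ≡⟨ sum-cong-≗ (λ c → trans (cong (_* π P c) (𝟙≼-unfold u c)) (*-distribʳ-+ (π P c) (𝟙 (u F.≟ c)) (below-parent c))) ⟩
    sum (λ c → 𝟙 (u F.≟ c) * π P c + below-parent c * π P c)
      ≡⟨ ∑-distrib-+ (λ c → 𝟙 (u F.≟ c) * π P c) (λ c → below-parent c * π P c) ⟩
    sum (λ c → 𝟙 (u F.≟ c) * π P c) + sum (λ c → below-parent c * π P c)
      ≡⟨ cong₂ _+_ self (sum-cong-≗ (λ c → cong (_* π P c) (sum-δ (λ w → 𝟙 (u ≼? w)) (pa c)))) ⟨
    π P u + sum (λ c → sum (λ w → 𝟙 (u ≼? w) * 𝟙 (pa c ≟ₘ just w)) * π P c)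
      ≡⟨ cong (π P u +_) (sum-matrix-assoc (λ w → 𝟙 (u ≼? w)) (λ w c → 𝟙 (pa c ≟ₘ just w)) (π P)) ⟨
    π P u + sum (λ w → 𝟙 (u ≼? w) * outflow w)
      ∎
    where
    open ≡-Reasoning
    below-parent : Fin n → ℚ
    below-parent c = maybe (λ k → 𝟙 (u ≼? k)) 0ℚ (pa c)
    self : π P u ≡ sum (λ c → 𝟙 (u F.≟ c) * π P c)
    self = sym (trans (sum-cong-≗ (λ c → *-comm (𝟙 (u F.≟ c)) (π P c))) (sum-δ (π P) (just u)))

  π≡subtree-absorbed : ∀ u → π P u ≡ sum (λ w → 𝟙 (u ≼? w) * absorbed w)
  π≡subtree-absorbed u = begin
    π P u                                                      ≡⟨ y+x-x≡y outflow-below (π P u) ⟨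
    π P u + outflow-below - outflow-below                      ≡⟨ cong (_- outflow-below) (subtree-balance u) ⟨
    sum (λ w → 𝟙 (u ≼? w) * π P w) - outflow-below             ≡⟨ sum-distrib-minus (λ w → 𝟙 (u ≼? w) * π P w) (λ w → 𝟙 (u ≼? w) * outflow w) ⟨
    sum (λ w → 𝟙 (u ≼? w) * π P w - 𝟙 (u ≼? w) * outflow w)     ≡⟨ sum-cong-≗ (λ w → x[y-z]≈xy-xz (𝟙 (u ≼? w)) (π P w) (outflow w)) ⟨
    sum (λ w → 𝟙 (u ≼? w) * absorbed w)                        ∎
    where
    open ≡-Reasoning
    outflow-below : ℚ
    outflow-below = sum (λ w → 𝟙 (u ≼? w) * outflow w)

  absorbedBelow : Subset n → ℚ
  absorbedBelow X = sum (λ w → 𝟙 (below? X w) * absorbed w)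

  absorbedBelow-mono : ∀ {X Y} → Y ⊆ X → absorbedBelow Y ≤ absorbedBelow X
  absorbedBelow-mono Y⊆X = sum-mono-≤ (λ w →
    *-monoʳ-≤-nonNeg (absorbed w) {{nonNegative (absorbed-nonneg w)}}
      (𝟙-mono (λ (y , y∈Y , y≼w) → y , Y⊆X y∈Y , y≼w) (below? _ w) (below? _ w)))

  subsetSum-top : ∀ {X T} → IsTop X T → subsetSum T (π P) ≡ absorbedBelow X
  subsetSum-top {X} {T} top = begin
    subsetSum T (π P)                                                  ≡⟨ subsetSum≡sum T (π P) ⟩
    sum (λ b → 𝟙 (b ∈? T) * π P b)                                     ≡⟨ sum-cong-≗ (λ b → cong (𝟙 (b ∈? T) *_) (π≡subtree-absorbed b)) ⟩
    sum (λ b → 𝟙 (b ∈? T) * sum (λ w → 𝟙 (b ≼? w) * absorbed w))       ≡⟨ sum-matrix-assoc (λ b → 𝟙 (b ∈? T)) (λ b w → 𝟙 (b ≼? w)) absorbed ⟩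
    sum (λ w → sum (λ b → 𝟙 (b ∈? T) * 𝟙 (b ≼? w)) * absorbed w)       ≡⟨ sum-cong-≗ (λ w → cong (_* absorbed w) (TopSet.top-count top w)) ⟩
    absorbedBelow X                                                    ∎
    where open ≡-Reasoning

lemma16 : ∀ {n} (t : RootedTree n) (P : Fin n → ℚ) → Transitions t P → (X Y TX TY : Subset n) → Y ⊆ X → RootedTree.IsTop t X TX → RootedTree.IsTop t Y TY → subsetSum TY (RootedTree.π t P) ≤ subsetSum TX (RootedTree.π t P)
lemma16 t P tr X Y TX TY Y⊆X topX topY = begin
  subsetSum TY (RootedTree.π t P)  ≡⟨ subsetSum-top topY ⟩
  absorbedBelow Y                  ≤⟨ absorbedBelow-mono Y⊆X ⟩
  absorbedBelow X                  ≡⟨ subsetSum-top topX ⟨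
  subsetSum TX (RootedTree.π t P)  ∎
  where
  open Absorption tr
  open ≤-Reasoning
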